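{- Let $G$ be an $r$-graph ($r\ge3$) with at least four vertices, let $e=uv$ be a solitary edge of $G$, and let $f$ be an edge such that $\{f\}$ is a cut of $G-u-v$ with shores $X$ and $Y$ of odd cardinality. Then $C:=\partial_G(X)$ and $D:=\partial_G(Y)$ are odd cuts of $G$ with exactly $r$ edges each, and they satisfy: (i) $C\cap D=\{f\}$; (ii) $X\cap Y=\emptyset$; (iii) $V(G)=X\cup Y\cup\{u,v\}$; (iv) $|\partial_G(u)\cap C|=|\partial_G(v)\cap D|$ and $|\partial_G(v)\cap C|=|\partial_G(u)\cap D|$; (v) $G-u-v$ is connected. Also, every edge $e'$ of the unique perfect matching of $G$ containing $e$ has multiplicity one (no other edge joins the ends of $e'$). Furthermore, if $G$ is $3$-edge-connected, then each of $u$ and $v$ has at least one neighbour in $X$ and at least one neighbour in $Y$, and $f$ is the only edge of $G-u-v$ forming a $1$-edge cut of $G-u-v$.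
   Context: Graphs are finite, loopless, possibly with multiple edges. For $X\subseteq V(G)$, $\partial_G(X)$ is the set of edges with exactly one end in $X$ ($\partial_G(u)=\partial_G(\{u\})$); it is odd if $|X|$ is odd; its shores are $X$ and $V\setminus X$. An $r$-graph is a connected $r$-regular graph in which every odd cut has at least $r$ edges. An edge is solitary if it lies in exactly one perfect matching. -}

module Defs where

open import Data.Nat using (ℕ; _≤_; _*_; _+_)
open import Data.Fin using (Fin)
open import Data.Bool using (Bool; _xor_; _∧_)
open import Data.Product using (Σ; _×_; _,_; proj₁; proj₂; ∃)
open import Data.Sum using (_⊎_)
open import Data.Vec using (lookup; tabulate)
open import Data.Fin.Subset using (Subset; _∈_; _∩_; ⁅_⁆; ∁; ∣_∣; Nonempty; ⊤)
open import Relation.Binary.PropositionalEquality using (_≡_; _≢_)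

record Graph : Set where
  field
    n : ℕ
    m : ℕ
    ends : Fin m → Fin n × Fin n
    loopless : ∀ e → proj₁ (ends e) ≢ proj₂ (ends e)
open Graph public

V : Graph → Set
V G = Fin (n G)

E : Graph → Set
E G = Fin (m G)

Joins : (G : Graph) → E G → V G → V G → Set
Joins G e x y = (ends G e ≡ (x , y)) ⊎ (ends G e ≡ (y , x))

Adjacent : (G : Graph) → V G → V G → Set
Adjacent G x y = ∃ λ e → Joins G e x y

∂ : (G : Graph) → Subset (n G) → Subset (m G)
∂ G X = tabulate λ e → lookup X (proj₁ (ends G e)) xor lookup X (proj₂ (ends G e))

∂v : (G : Graph) → V G → Subset (m G)
∂v G x = ∂ G ⁅ x ⁆

EdgesIn : (G : Graph) → Subset (n G) → Subset (m G)
EdgesIn G S = tabulate λ e → lookup S (proj₁ (ends G e)) ∧ lookup S (proj₂ (ends G e))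

∂In : (G : Graph) → Subset (n G) → Subset (n G) → Subset (m G)
∂In G S X = ∂ G X ∩ EdgesIn G S

Odd : ℕ → Set
Odd k = ∃ λ j → k ≡ 1 + 2 * j

data Reach (G : Graph) (S : Subset (n G)) (x : V G) : V G → Set where
  here : x ∈ S → Reach G S x x
  step : ∀ {y z} (e : E G) → Reach G S x y → Joins G e y z → z ∈ S → Reach G S x z

ConnectedOn : (G : Graph) → Subset (n G) → Set
ConnectedOn G S = ∀ x y → x ∈ S → y ∈ S → Reach G S x y

Connected : Graph → Set
Connected G = ConnectedOn G ⊤

Regular : ℕ → Graph → Set
Regular r G = ∀ x → ∣ ∂v G x ∣ ≡ r

IsRGraph : ℕ → Graph → Set
IsRGraph r G = Connected G × Regular r G × (∀ X → Odd ∣ X ∣ → r ≤ ∣ ∂ G X ∣)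

PerfectMatching : (G : Graph) → Subset (m G) → Set
PerfectMatching G M = ∀ x → ∣ ∂v G x ∩ M ∣ ≡ 1

Solitary : (G : Graph) → E G → Set
Solitary G e = Σ (Subset (m G)) λ M → PerfectMatching G M × e ∈ M
  × (∀ M' → PerfectMatching G M' → e ∈ M' → M' ≡ M)

EdgeConnected : ℕ → Graph → Set
EdgeConnected k G = ∀ X → Nonempty X → Nonempty (∁ X) → k ≤ ∣ ∂ G X ∣

module Submission where

-- Everything is edge counting over the partition V(G) = X ∪ Y ∪ {u} ∪ {v}.  Splitting the
-- degrees of X, Y, u and v over the other parts, |∂X ∩ ∂Y| = 1, the odd-cut bounds
-- |∂X|, |∂Y| ≥ r and e ∈ ∂u ∩ ∂v force |∂X| = |∂Y| = r, a single u–v edge and (iv).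
-- A component K of G − u − v cannot split an odd shore T ∈ {X, Y}: the two halves would
-- have cuts adding up to r, so the even half would have an empty cut in the connected G;
-- f then puts both shores into K.  A parallel copy of an edge of the perfect matching
-- through e could be exchanged for it, giving a second perfect matching through e.
-- In the 3-edge-connected case a vertex u with no neighbour in X would make ∂(X ∪ {v}) a
-- 2-edge cut, and a second bridge g of G − u − v would cut odd parts P ⊆ X, Q ⊆ Y out of
-- the shores, leaving a nonempty rest W of G − u − v with |∂W| ≤ 2.

open import Defs
open import Data.Nat using (ℕ; zero; suc; _≤_; _<_; _+_; _*_; s≤s)
open import Data.Nat.Properties hiding (_≟_)
open import Data.Nat.Tactic.RingSolver using (solve-∀)
open import Data.Bool using (Bool; true; false; _∧_; _∨_; not; _xor_)
open import Data.Bool.Properties using (xor-comm; ∧-comm; not-involutive)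
open import Data.Fin using (Fin; _≟_)
import Data.Fin.Permutation as Perm
import Data.Fin.Permutation.Components as PC
open import Data.Vec using ([]; _∷_; here; lookup; tabulate)
open import Data.Vec.Properties
  using (lookup∘tabulate; tabulate∘lookup; tabulate-cong; lookup-zipWith; lookup-map; lookup-replicate;
         []=⇒lookup; lookup⇒[]=)
open import Data.Product using (_×_; _,_; ∃; ∃₂; proj₁; proj₂)
open import Data.Sum using (_⊎_; inj₁; inj₂)
open import Data.Fin.Subset
  using (Subset; _∈_; _∉_; _∩_; _∪_; _─_; _-_; _⊆_; ⁅_⁆; ∁; ∣_∣; ⊤; ⊥; Nonempty; Empty)
open import Data.Fin.Subset.Properties
open import Algebra.Properties.Semiring.Sum +-*-semiring
  using (sum; sum-cong-≗; ∑-distrib-+; *-distribˡ-sum; sum-permute)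
open import Relation.Binary.PropositionalEquality
open import Relation.Nullary using (Dec; yes; no; contradiction)
open import Function using (_∘_; case_of_)

𝟙 : Bool → ℕ
𝟙 true  = 1
𝟙 false = 0

χ : ∀ {k} → Subset k → Fin k → ℕ
χ p i = 𝟙 (lookup p i)

∣p∣≡∑χ : ∀ {k} (p : Subset k) → ∣ p ∣ ≡ sum (χ p)
∣p∣≡∑χ []          = refl
∣p∣≡∑χ (true  ∷ p) = cong suc (∣p∣≡∑χ p)
∣p∣≡∑χ (false ∷ p) = ∣p∣≡∑χ p

subset-ext : ∀ {k} {p q : Subset k} → (∀ i → lookup p i ≡ lookup q i) → p ≡ q
subset-ext {p = p} {q} p≗q = begin
  p                    ≡⟨ tabulate∘lookup p ⟨
  tabulate (lookup p)  ≡⟨ tabulate-cong p≗q ⟩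
  tabulate (lookup q)  ≡⟨ tabulate∘lookup q ⟩
  q                    ∎
  where open ≡-Reasoning

p∩[q─p]≡⊥ : ∀ {k} (p q : Subset k) → p ∩ (q ─ p) ≡ ⊥
p∩[q─p]≡⊥ []          []      = refl
p∩[q─p]≡⊥ (true  ∷ p) (_ ∷ q) = cong (false ∷_) (p∩[q─p]≡⊥ p q)
p∩[q─p]≡⊥ (false ∷ p) (_ ∷ q) = cong (false ∷_) (p∩[q─p]≡⊥ p q)

p∪[q─p]≡q : ∀ {k} {p q : Subset k} → p ⊆ q → p ∪ (q ─ p) ≡ q
p∪[q─p]≡q {p = []}        {[]}        _   = refl
p∪[q─p]≡q {p = true  ∷ p} {true  ∷ q} p⊆q = cong (true ∷_) (p∪[q─p]≡q (drop-∷-⊆ p⊆q))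
p∪[q─p]≡q {p = true  ∷ p} {false ∷ q} p⊆q = contradiction (p⊆q here) λ ()
p∪[q─p]≡q {p = false ∷ p} {y     ∷ q} p⊆q = cong (y ∷_) (p∪[q─p]≡q (drop-∷-⊆ p⊆q))

∣p∣≡∣p∩q∣+∣p∩∁q∣ : ∀ {k} (p q : Subset k) → ∣ p ∣ ≡ ∣ p ∩ q ∣ + ∣ p ∩ ∁ q ∣
∣p∣≡∣p∩q∣+∣p∩∁q∣ []          []          = refl
∣p∣≡∣p∩q∣+∣p∩∁q∣ (true  ∷ p) (true  ∷ q) = cong suc (∣p∣≡∣p∩q∣+∣p∩∁q∣ p q)
∣p∣≡∣p∩q∣+∣p∩∁q∣ (true  ∷ p) (false ∷ q) =
  trans (cong suc (∣p∣≡∣p∩q∣+∣p∩∁q∣ p q)) (sym (+-suc _ _))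
∣p∣≡∣p∩q∣+∣p∩∁q∣ (false ∷ p) (_     ∷ q) = ∣p∣≡∣p∩q∣+∣p∩∁q∣ p q

∣p∪q∣+∣p∩q∣≡∣p∣+∣q∣ : ∀ {k} (p q : Subset k) → ∣ p ∪ q ∣ + ∣ p ∩ q ∣ ≡ ∣ p ∣ + ∣ q ∣
∣p∪q∣+∣p∩q∣≡∣p∣+∣q∣ []          []          = refl
∣p∪q∣+∣p∩q∣≡∣p∣+∣q∣ (true  ∷ p) (true  ∷ q) =
  cong suc (trans (+-suc _ _) (trans (cong suc (∣p∪q∣+∣p∩q∣≡∣p∣+∣q∣ p q)) (sym (+-suc _ _))))
∣p∪q∣+∣p∩q∣≡∣p∣+∣q∣ (true  ∷ p) (false ∷ q) = cong suc (∣p∪q∣+∣p∩q∣≡∣p∣+∣q∣ p q)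
∣p∪q∣+∣p∩q∣≡∣p∣+∣q∣ (false ∷ p) (true  ∷ q) =
  trans (cong suc (∣p∪q∣+∣p∩q∣≡∣p∣+∣q∣ p q)) (sym (+-suc _ _))
∣p∪q∣+∣p∩q∣≡∣p∣+∣q∣ (false ∷ p) (false ∷ q) = ∣p∪q∣+∣p∩q∣≡∣p∣+∣q∣ p q

module _ {k : ℕ} where

  lookup-∩ : ∀ (p q : Subset k) i → lookup (p ∩ q) i ≡ (lookup p i ∧ lookup q i)
  lookup-∩ p q i = lookup-zipWith _∧_ i p q

  lookup-∪ : ∀ (p q : Subset k) i → lookup (p ∪ q) i ≡ (lookup p i ∨ lookup q i)
  lookup-∪ p q i = lookup-zipWith _∨_ i p q

  lookup-∁ : ∀ (p : Subset k) i → lookup (∁ p) i ≡ not (lookup p i)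
  lookup-∁ p i = lookup-map i not p

  ∈⇒lookup : ∀ {p : Subset k} {i} → i ∈ p → lookup p i ≡ true
  ∈⇒lookup = []=⇒lookup

  lookup⇒∈ : ∀ {p : Subset k} {i} → lookup p i ≡ true → i ∈ p
  lookup⇒∈ = lookup⇒[]= _ _

  ∉⇒lookup : ∀ {p : Subset k} {i} → i ∉ p → lookup p i ≡ false
  ∉⇒lookup {p} {i} i∉p with lookup p i in eq
  ... | true  = contradiction (lookup⇒∈ eq) i∉p
  ... | false = refl

  lookup⇒∉ : ∀ {p : Subset k} {i} → lookup p i ≡ false → i ∉ p
  lookup⇒∉ p[i]≡false i∈p with () ← trans (sym p[i]≡false) (∈⇒lookup i∈p)

  p∩q≡⊥⁺ : ∀ {p q : Subset k} → (∀ {i} → i ∈ p → i ∉ q) → p ∩ q ≡ ⊥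
  p∩q≡⊥⁺ {p} {q} p∩q=∅ = Empty-unique λ (i , i∈p∩q) →
    let (i∈p , i∈q) = x∈p∩q⁻ p q i∈p∩q in p∩q=∅ i∈p i∈q

  p∩q≡⊥⁻ : ∀ {p q : Subset k} {i} → p ∩ q ≡ ⊥ → i ∈ p → i ∉ q
  p∩q≡⊥⁻ p∩q≡⊥ i∈p i∈q = ∉⊥ (subst (_ ∈_) p∩q≡⊥ (x∈p∩q⁺ (i∈p , i∈q)))

  p∩q≡⊥⇒∧≡false : ∀ {p q : Subset k} → p ∩ q ≡ ⊥ → ∀ i → (lookup p i ∧ lookup q i) ≡ false
  p∩q≡⊥⇒∧≡false {p} {q} p∩q≡⊥ i = begin
    lookup p i ∧ lookup q i  ≡⟨ lookup-∩ p q i ⟨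
    lookup (p ∩ q) i         ≡⟨ cong (λ s → lookup s i) p∩q≡⊥ ⟩
    lookup ⊥ i               ≡⟨ lookup-replicate i false ⟩
    false                    ∎
    where open ≡-Reasoning

  x∉p⇒⁅x⁆∩p≡⊥ : ∀ {p : Subset k} {i} → i ∉ p → ⁅ i ⁆ ∩ p ≡ ⊥
  x∉p⇒⁅x⁆∩p≡⊥ {p} {i} i∉p = p∩q≡⊥⁺ λ j∈⁅i⁆ j∈p → i∉p (subst (_∈ p) (x∈⁅y⁆⇒x≡y i j∈⁅i⁆) j∈p)

  x∈p─q⇒x∉q : ∀ {p q : Subset k} {i} → i ∈ p ─ q → i ∉ q
  x∈p─q⇒x∉q {p} {q} i∈p─q i∈q = p∩q≡⊥⁻ (p∩[q─p]≡⊥ q p) i∈q i∈p─q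

  Empty[p∩∁q]⇒p⊆q : ∀ {p q : Subset k} → Empty (p ∩ ∁ q) → p ⊆ q
  Empty[p∩∁q]⇒p⊆q {q = q} ∄ {i} i∈p with i ∈? q
  ... | yes i∈q = i∈q
  ... | no  i∉q = contradiction (i , x∈p∩q⁺ (i∈p , x∉p⇒x∈∁p i∉q)) ∄

  Empty⇒∣p∣≡0 : ∀ {p : Subset k} → Empty p → ∣ p ∣ ≡ 0
  Empty⇒∣p∣≡0 ∄ = trans (cong ∣_∣ (Empty-unique ∄)) (∣⊥∣≡0 k)

  x∈p⇒0<∣p∣ : ∀ {p : Subset k} {i} → i ∈ p → 0 < ∣ p ∣
  x∈p⇒0<∣p∣ {p} {i} i∈p = subst (_≤ ∣ p ∣) (∣⁅x⁆∣≡1 i) (p⊆q⇒∣p∣≤∣q∣ ⁅i⁆⊆p)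
    where
    ⁅i⁆⊆p : ⁅ i ⁆ ⊆ p
    ⁅i⁆⊆p j∈⁅i⁆ = subst (_∈ p) (sym (x∈⁅y⁆⇒x≡y i j∈⁅i⁆)) i∈p

  ∣p∣≡1⇒unique : ∀ {p : Subset k} {i j} → ∣ p ∣ ≡ 1 → i ∈ p → j ∈ p → i ≡ j
  ∣p∣≡1⇒unique {p} {i} {j} ∣p∣≡1 i∈p j∈p with i ≟ j
  ... | yes i≡j = i≡j
  ... | no  i≢j = contradiction ∣p-j∣<1 (≤⇒≯ (x∈p⇒0<∣p∣ (x∈p∧x≢y⇒x∈p-y i∈p i≢j)))
    where
    ∣p-j∣<1 : ∣ p - j ∣ < 1
    ∣p-j∣<1 = subst (∣ p - j ∣ <_) ∣p∣≡1 (x∈p⇒∣p-x∣<∣p∣ j∈p)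

  ∣p∩q∣≡∣q∩p∣ : ∀ (p q : Subset k) → ∣ p ∩ q ∣ ≡ ∣ q ∩ p ∣
  ∣p∩q∣≡∣q∩p∣ p q = cong ∣_∣ (∩-comm p q)

  ∣p∣+∣q∣≤∣r∣ : ∀ {p q r : Subset k} → p ∩ q ≡ ⊥ → p ⊆ r → q ⊆ r → ∣ p ∣ + ∣ q ∣ ≤ ∣ r ∣
  ∣p∣+∣q∣≤∣r∣ {p} {q} {r} p∩q≡⊥ p⊆r q⊆r = begin
    ∣ p ∣ + ∣ q ∣           ≡⟨ ∣p∪q∣+∣p∩q∣≡∣p∣+∣q∣ p q ⟨
    ∣ p ∪ q ∣ + ∣ p ∩ q ∣   ≡⟨ cong (λ t → ∣ p ∪ q ∣ + ∣ t ∣) p∩q≡⊥ ⟩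
    ∣ p ∪ q ∣ + ∣ ⊥ {k} ∣   ≡⟨ cong (∣ p ∪ q ∣ +_) (∣⊥∣≡0 k) ⟩
    ∣ p ∪ q ∣ + 0           ≡⟨ +-identityʳ _ ⟩
    ∣ p ∪ q ∣               ≤⟨ p⊆q⇒∣p∣≤∣q∣ p∪q⊆r ⟩
    ∣ r ∣                   ∎
    where
    open ≤-Reasoning
    p∪q⊆r : p ∪ q ⊆ r
    p∪q⊆r i∈p∪q with x∈p∪q⁻ p q i∈p∪q
    ... | inj₁ i∈p = p⊆r i∈p
    ... | inj₂ i∈q = q⊆r i∈q

  ∣⁅i⁆∪⁅j⁆∣≤2 : ∀ (i j : Fin k) → ∣ ⁅ i ⁆ ∪ ⁅ j ⁆ ∣ ≤ 2
  ∣⁅i⁆∪⁅j⁆∣≤2 i j = ≤-trans (m≤m+n _ ∣ ⁅ i ⁆ ∩ ⁅ j ⁆ ∣) (≤-reflexive (begin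
    ∣ ⁅ i ⁆ ∪ ⁅ j ⁆ ∣ + ∣ ⁅ i ⁆ ∩ ⁅ j ⁆ ∣  ≡⟨ ∣p∪q∣+∣p∩q∣≡∣p∣+∣q∣ ⁅ i ⁆ ⁅ j ⁆ ⟩
    ∣ ⁅ i ⁆ ∣ + ∣ ⁅ j ⁆ ∣                  ≡⟨ cong₂ _+_ (∣⁅x⁆∣≡1 i) (∣⁅x⁆∣≡1 j) ⟩
    2                                      ∎))
    where open ≡-Reasoning

  pointwise⇒∣p∣+∣q∣≡∣r∣+2∣s∣ : ∀ {p q r s : Subset k} →
    (∀ i → χ p i + χ q i ≡ χ r i + 2 * χ s i) → ∣ p ∣ + ∣ q ∣ ≡ ∣ r ∣ + 2 * ∣ s ∣
  pointwise⇒∣p∣+∣q∣≡∣r∣+2∣s∣ {p} {q} {r} {s} pointwise = begin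
    ∣ p ∣ + ∣ q ∣                       ≡⟨ cong₂ _+_ (∣p∣≡∑χ p) (∣p∣≡∑χ q) ⟩
    sum (χ p) + sum (χ q)               ≡⟨ ∑-distrib-+ (χ p) (χ q) ⟨
    sum (λ i → χ p i + χ q i)           ≡⟨ sum-cong-≗ pointwise ⟩
    sum (λ i → χ r i + 2 * χ s i)       ≡⟨ ∑-distrib-+ (χ r) (λ i → 2 * χ s i) ⟩
    sum (χ r) + sum (λ i → 2 * χ s i)   ≡⟨ cong (sum (χ r) +_) (*-distribˡ-sum 2 (χ s)) ⟨
    sum (χ r) + 2 * sum (χ s)           ≡⟨ cong₂ (λ a b → a + 2 * b) (∣p∣≡∑χ r) (∣p∣≡∑χ s) ⟨
    ∣ r ∣ + 2 * ∣ s ∣                   ∎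
    where open ≡-Reasoning

  pointwise⇒∣p∣≡∣q∣+∣r∣+∣s∣ : ∀ {p q r s : Subset k} →
    (∀ i → χ p i ≡ χ q i + χ r i + χ s i) → ∣ p ∣ ≡ ∣ q ∣ + ∣ r ∣ + ∣ s ∣
  pointwise⇒∣p∣≡∣q∣+∣r∣+∣s∣ {p} {q} {r} {s} pointwise = begin
    ∣ p ∣                                   ≡⟨ ∣p∣≡∑χ p ⟩
    sum (χ p)                               ≡⟨ sum-cong-≗ pointwise ⟩
    sum (λ i → χ q i + χ r i + χ s i)       ≡⟨ ∑-distrib-+ (λ i → χ q i + χ r i) (χ s) ⟩
    sum (λ i → χ q i + χ r i) + sum (χ s)   ≡⟨ cong (_+ sum (χ s)) (∑-distrib-+ (χ q) (χ r)) ⟩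
    sum (χ q) + sum (χ r) + sum (χ s)       ≡⟨ cong₂ _+_ (cong₂ _+_ (∣p∣≡∑χ q) (∣p∣≡∑χ r)) (∣p∣≡∑χ s) ⟨
    ∣ q ∣ + ∣ r ∣ + ∣ s ∣                   ∎
    where open ≡-Reasoning

module _ {k : ℕ} where

  transpose-invariant : ∀ {A : Set} (f : Fin k → A) {i j} → f i ≡ f j → ∀ l → f (PC.transpose i j l) ≡ f l
  transpose-invariant f {i} {j} fi≡fj l with l ≟ i
  ... | yes refl = sym fi≡fj
  ... | no  _ with l ≟ j
  ...   | yes refl = fi≡fj
  ...   | no  _    = refl

  transpose-fixes : ∀ {i j l : Fin k} → l ≢ i → l ≢ j → PC.transpose i j l ≡ l
  transpose-fixes {i} {j} {l} l≢i l≢j with l ≟ i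
  ... | yes l≡i = contradiction l≡i l≢i
  ... | no  _ with l ≟ j
  ...   | yes l≡j = contradiction l≡j l≢j
  ...   | no  _   = refl

  transpose-j≡i : ∀ (i j : Fin k) → PC.transpose i j j ≡ i
  transpose-j≡i i j with j ≟ i
  ... | yes j≡i = j≡i
  ... | no  _ with j ≟ j
  ...   | yes _   = refl
  ...   | no  j≢j = contradiction refl j≢j

  swap : Fin k → Fin k → Subset k → Subset k
  swap i j p = tabulate (lookup p ∘ PC.transpose i j)

  lookup-swap : ∀ i j (p : Subset k) l → lookup (swap i j p) l ≡ lookup p (PC.transpose i j l)
  lookup-swap i j p = lookup∘tabulate (lookup p ∘ PC.transpose i j)

  ∣swap∣ : ∀ i j (p : Subset k) → ∣ swap i j p ∣ ≡ ∣ p ∣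
  ∣swap∣ i j p = begin
    ∣ swap i j p ∣                ≡⟨ ∣p∣≡∑χ (swap i j p) ⟩
    sum (χ (swap i j p))          ≡⟨ sum-cong-≗ (cong 𝟙 ∘ lookup-swap i j p) ⟩
    sum (χ p ∘ PC.transpose i j)  ≡⟨ sum-permute (χ p) (Perm.transpose i j) ⟨
    sum (χ p)                     ≡⟨ ∣p∣≡∑χ p ⟨
    ∣ p ∣                         ∎
    where open ≡-Reasoning

  swap-∩ : ∀ i j (p q : Subset k) → swap i j (p ∩ q) ≡ swap i j p ∩ swap i j q
  swap-∩ i j p q = subset-ext λ l → begin
    lookup (swap i j (p ∩ q)) l                    ≡⟨ lookup-swap i j (p ∩ q) l ⟩
    lookup (p ∩ q) (PC.transpose i j l)            ≡⟨ lookup-∩ p q _ ⟩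
    lookup p (PC.transpose i j l) ∧ lookup q (PC.transpose i j l)
                                                   ≡⟨ cong₂ _∧_ (lookup-swap i j p l) (lookup-swap i j q l) ⟨
    lookup (swap i j p) l ∧ lookup (swap i j q) l  ≡⟨ lookup-∩ (swap i j p) (swap i j q) l ⟨
    lookup (swap i j p ∩ swap i j q) l             ∎
    where open ≡-Reasoning

  swap-invariant : ∀ {i j} (p : Subset k) → lookup p i ≡ lookup p j → swap i j p ≡ p
  swap-invariant {i} {j} p pi≡pj = subset-ext λ l →
    trans (lookup-swap i j p l) (transpose-invariant (lookup p) pi≡pj l)

Odd-1 : Odd 1
Odd-1 = 0 , refl

Odd-2+⁻ : ∀ {a} → Odd (2 + a) → Odd a
Odd-2+⁻ (suc j , 2+a≡1+2[1+j]) = j , trans (suc-injective (suc-injective 2+a≡1+2[1+j])) (+-suc j (j + 0))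

Odd-2+⁺ : ∀ {a} → Odd a → Odd (2 + a)
Odd-2+⁺ (j , a≡1+2j) = suc j , cong (2 +_) (trans a≡1+2j (sym (+-suc j (j + 0))))

Odd-+ : ∀ a {b} → Odd (a + b) → Odd a ⊎ Odd b
Odd-+ zero          odd = inj₂ odd
Odd-+ (suc zero)    _   = inj₁ Odd-1
Odd-+ (suc (suc a)) odd with Odd-+ a (Odd-2+⁻ odd)
... | inj₁ odd-a = inj₁ (Odd-2+⁺ odd-a)
... | inj₂ odd-b = inj₂ odd-b

m+n≡o≤m⇒n≡0 : ∀ {m n o} → m + n ≡ o → o ≤ m → n ≡ 0
m+n≡o≤m⇒n≡0 {m} {n} m+n≡o o≤m =
  n≤0⇒n≡0 (+-cancelˡ-≤ m n 0 (≤-trans (≤-reflexive m+n≡o) (≤-trans o≤m (≤-reflexive (sym (+-identityʳ m))))))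

module _ where
  open ≤-Reasoning

  degree-arithmetic : ∀ {r x y k a b c d} →
    x ≡ 1 + a + c → y ≡ 1 + b + d → r ≡ a + b + k → r ≡ c + d + k → r ≤ x → r ≤ y → 1 ≤ k →
    x ≡ r × y ≡ r × k ≡ 1 × a ≡ d × c ≡ b
  degree-arithmetic {k = k} {a} {b} {c} {d} refl refl refl ab+k≡cd+k r≤x r≤y 1≤k =
    x≡r , y≡r , k≡1 , a≡d , sym b≡c
    where
    b+k≤1+c : b + k ≤ 1 + c
    b+k≤1+c = +-cancelˡ-≤ a (b + k) (1 + c) (begin
      a + (b + k)  ≡⟨ +-assoc a b k ⟨
      a + b + k    ≤⟨ r≤x ⟩
      1 + a + c    ≡⟨ +-suc a c ⟨
      a + (1 + c)  ∎)

    c+k≤1+b : c + k ≤ 1 + b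
    c+k≤1+b = +-cancelʳ-≤ d (c + k) (1 + b) (begin
      c + k + d    ≡⟨ +-assoc c k d ⟩
      c + (k + d)  ≡⟨ cong (c +_) (+-comm k d) ⟩
      c + (d + k)  ≡⟨ +-assoc c d k ⟨
      c + d + k    ≡⟨ ab+k≡cd+k ⟨
      a + b + k    ≤⟨ r≤y ⟩
      1 + b + d    ∎)

    b≡c : b ≡ c
    b≡c = ≤-antisym
      (+-cancelʳ-≤ 1 b c (≤-trans (+-monoʳ-≤ b 1≤k) (≤-trans b+k≤1+c (≤-reflexive (+-comm 1 c)))))
      (+-cancelʳ-≤ 1 c b (≤-trans (+-monoʳ-≤ c 1≤k) (≤-trans c+k≤1+b (≤-reflexive (+-comm 1 b)))))

    k≡1 : k ≡ 1
    k≡1 = ≤-antisym (+-cancelˡ-≤ b k 1 (begin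
      b + k  ≤⟨ b+k≤1+c ⟩
      1 + c  ≡⟨ cong suc b≡c ⟨
      1 + b  ≡⟨ +-comm 1 b ⟩
      b + 1  ∎)) 1≤k

    a≡d : a ≡ d
    a≡d = +-cancelʳ-≡ b a d (begin-equality
      a + b  ≡⟨ +-cancelʳ-≡ k (a + b) (c + d) ab+k≡cd+k ⟩
      c + d  ≡⟨ cong (_+ d) b≡c ⟨
      b + d  ≡⟨ +-comm b d ⟩
      d + b  ∎)

    x≡r : 1 + a + c ≡ a + b + k
    x≡r = begin-equality
      1 + a + c  ≡⟨ cong (λ t → 1 + a + t) b≡c ⟨
      1 + a + b  ≡⟨ +-comm (a + b) 1 ⟨
      a + b + 1  ≡⟨ cong (a + b +_) k≡1 ⟨
      a + b + k  ∎

    y≡r : 1 + b + d ≡ a + b + k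
    y≡r = begin-equality
      1 + b + d  ≡⟨ cong (λ t → 1 + t + d) b≡c ⟩
      1 + c + d  ≡⟨ +-comm (c + d) 1 ⟨
      c + d + 1  ≡⟨ cong (c + d +_) k≡1 ⟨
      c + d + k  ≡⟨ ab+k≡cd+k ⟨
      a + b + k  ∎

  two-edge-cut-arithmetic : ∀ {r z c} → r + r ≡ z + 2 * c → 1 + c ≡ r → z ≡ 2
  two-edge-cut-arithmetic {z = z} {c} r+r≡z+2c refl = +-cancelʳ-≡ (2 * c) z 2 (begin-equality
    z + 2 * c        ≡⟨ r+r≡z+2c ⟨
    1 + c + (1 + c)  ≡⟨ double-suc c ⟩
    2 + 2 * c        ∎)
    where
    double-suc : ∀ c → 1 + c + (1 + c) ≡ 2 + 2 * c
    double-suc = solve-∀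

  three-part-arithmetic : ∀ {r p q pq w s e₁ e₂} →
    p + q ≡ pq + 2 * e₁ → pq + w ≡ s + 2 * e₂ → s + 2 ≡ r + r → r ≤ p → r ≤ q → e₁ + e₂ ≤ 2 → w ≤ 2
  three-part-arithmetic {r} {p} {q} {pq} {w} {s} {e₁} {e₂} p+q≡ pq+w≡ s+2≡ r≤p r≤q e≤2 =
    +-cancelˡ-≤ (r + r) w 2 (begin
      r + r + w            ≤⟨ +-monoˡ-≤ w (+-mono-≤ r≤p r≤q) ⟩
      p + q + w            ≡⟨ cong (_+ w) p+q≡ ⟩
      pq + 2 * e₁ + w      ≡⟨ swap-last pq (2 * e₁) w ⟩
      pq + w + 2 * e₁      ≡⟨ cong (_+ 2 * e₁) pq+w≡ ⟩
      s + 2 * e₂ + 2 * e₁  ≡⟨ collect s e₁ e₂ ⟩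
      s + 2 * (e₁ + e₂)    ≤⟨ +-monoʳ-≤ s (*-monoʳ-≤ 2 e≤2) ⟩
      s + 4                ≡⟨ +-assoc s 2 2 ⟨
      s + 2 + 2            ≡⟨ cong (_+ 2) s+2≡ ⟩
      r + r + 2            ∎)
    where
    swap-last : ∀ a b c → a + b + c ≡ a + c + b
    swap-last = solve-∀
    collect : ∀ s e₁ e₂ → s + 2 * e₂ + 2 * e₁ ≡ s + 2 * (e₁ + e₂)
    collect = solve-∀

xor-count : ∀ a b a′ b′ → (a ∧ b) ≡ false → (a′ ∧ b′) ≡ false →
  𝟙 (a xor a′) + 𝟙 (b xor b′) ≡ 𝟙 ((a ∨ b) xor (a′ ∨ b′)) + 2 * 𝟙 ((a xor a′) ∧ (b xor b′))
xor-count true  true  _     _     ()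
xor-count _     _     true  true  _  ()
xor-count true  false true  false _  _ = refl
xor-count true  false false true  _  _ = refl
xor-count true  false false false _  _ = refl
xor-count false true  true  false _  _ = refl
xor-count false true  false true  _  _ = refl
xor-count false true  false false _  _ = refl
xor-count false false true  false _  _ = refl
xor-count false false false true  _  _ = refl
xor-count false false false false _  _ = refl

data OneOf₄ : Bool → Bool → Bool → Bool → Set where
  1st : OneOf₄ true  false false false
  2nd : OneOf₄ false true  false false
  3rd : OneOf₄ false false true  false
  4th : OneOf₄ false false false true

module _ {a b c d : Bool} where

  OneOf₄-swap₁₂ : OneOf₄ a b c d → OneOf₄ b a c d
  OneOf₄-swap₁₂ 1st = 2nd
  OneOf₄-swap₁₂ 2nd = 1st
  OneOf₄-swap₁₂ 3rd = 3rd
  OneOf₄-swap₁₂ 4th = 4th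

  OneOf₄-swap₂₃ : OneOf₄ a b c d → OneOf₄ a c b d
  OneOf₄-swap₂₃ 1st = 1st
  OneOf₄-swap₂₃ 2nd = 3rd
  OneOf₄-swap₂₃ 3rd = 2nd
  OneOf₄-swap₂₃ 4th = 4th

  OneOf₄-swap₃₄ : OneOf₄ a b c d → OneOf₄ a b d c
  OneOf₄-swap₃₄ 1st = 1st
  OneOf₄-swap₃₄ 2nd = 2nd
  OneOf₄-swap₃₄ 3rd = 4th
  OneOf₄-swap₃₄ 4th = 3rd

degree-count : ∀ {a b c d a′ b′ c′ d′} → OneOf₄ a b c d → OneOf₄ a′ b′ c′ d′ →
  𝟙 (a xor a′) ≡ 𝟙 ((a xor a′) ∧ (b xor b′)) + 𝟙 ((a xor a′) ∧ (c xor c′)) + 𝟙 ((a xor a′) ∧ (d xor d′))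
degree-count 1st 1st = refl
degree-count 1st 2nd = refl
degree-count 1st 3rd = refl
degree-count 1st 4th = refl
degree-count 2nd 1st = refl
degree-count 2nd 2nd = refl
degree-count 2nd 3rd = refl
degree-count 2nd 4th = refl
degree-count 3rd 1st = refl
degree-count 3rd 2nd = refl
degree-count 3rd 3rd = refl
degree-count 3rd 4th = refl
degree-count 4th 1st = refl
degree-count 4th 2nd = refl
degree-count 4th 3rd = refl
degree-count 4th 4th = refl

record Partition₄ {k} (A B C D : Subset k) : Set where
  constructor partition₄
  field one-of : ∀ i → OneOf₄ (lookup A i) (lookup B i) (lookup C i) (lookup D i)
open Partition₄

module _ {k} {A B C D : Subset k} where

  Partition₄-swap₁₂ : Partition₄ A B C D → Partition₄ B A C D
  Partition₄-swap₁₂ P = partition₄ (OneOf₄-swap₁₂ ∘ one-of P)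

  Partition₄-swap₂₃ : Partition₄ A B C D → Partition₄ A C B D
  Partition₄-swap₂₃ P = partition₄ (OneOf₄-swap₂₃ ∘ one-of P)

  Partition₄-swap₃₄ : Partition₄ A B C D → Partition₄ A B D C
  Partition₄-swap₃₄ P = partition₄ (OneOf₄-swap₃₄ ∘ one-of P)

-- Cuts

module Cuts (G : Graph) where

  end₁ end₂ : E G → V G
  end₁ h = proj₁ (ends G h)
  end₂ h = proj₂ (ends G h)

  joins-ends : ∀ h → Joins G h (end₁ h) (end₂ h)
  joins-ends h = inj₁ refl

  joins-sym : ∀ {h x y} → Joins G h x y → Joins G h y x
  joins-sym (inj₁ eq) = inj₂ eq
  joins-sym (inj₂ eq) = inj₁ eq

  joins-≢ : ∀ {h x y} → Joins G h x y → x ≢ y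
  joins-≢ {h} (inj₁ refl) = loopless G h
  joins-≢ {h} (inj₂ refl) = loopless G h ∘ sym

  ∂-lookup : ∀ A h → lookup (∂ G A) h ≡ (lookup A (end₁ h) xor lookup A (end₂ h))
  ∂-lookup A = lookup∘tabulate _

  EdgesIn-lookup : ∀ S h → lookup (EdgesIn G S) h ≡ (lookup S (end₁ h) ∧ lookup S (end₂ h))
  EdgesIn-lookup S = lookup∘tabulate _

  ∂-joins : ∀ {A h x y} → Joins G h x y → lookup (∂ G A) h ≡ (lookup A x xor lookup A y)
  ∂-joins {A} {h} (inj₁ refl) = ∂-lookup A h
  ∂-joins {A} {h} (inj₂ refl) = trans (∂-lookup A h) (xor-comm (lookup A (end₁ h)) _)

  EdgesIn-joins : ∀ {S h x y} → Joins G h x y → lookup (EdgesIn G S) h ≡ (lookup S x ∧ lookup S y)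
  EdgesIn-joins {S} {h} (inj₁ refl) = EdgesIn-lookup S h
  EdgesIn-joins {S} {h} (inj₂ refl) = trans (EdgesIn-lookup S h) (∧-comm (lookup S (end₁ h)) _)

  crossing⇒∈∂ : ∀ {A h x y} → Joins G h x y → x ∈ A → y ∉ A → h ∈ ∂ G A
  crossing⇒∈∂ {A} j x∈A y∉A = lookup⇒∈ (trans (∂-joins {A} j) (cong₂ _xor_ (∈⇒lookup x∈A) (∉⇒lookup y∉A)))

  joins⇒∈∂v : ∀ {h x y} → Joins G h x y → h ∈ ∂v G x
  joins⇒∈∂v {x = x} j = crossing⇒∈∂ j (x∈⁅x⁆ x) (joins-≢ j ∘ sym ∘ x∈⁅y⁆⇒x≡y x)

  ∈∂-ends : ∀ {A h x y} → Joins G h x y → h ∈ ∂ G A → (x ∈ A × y ∉ A) ⊎ (x ∉ A × y ∈ A)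
  ∈∂-ends {A} {h} {x} {y} j h∈∂A
    with lookup A x in ax | lookup A y in ay | trans (sym (∂-joins {A} j)) (∈⇒lookup h∈∂A)
  ... | true  | false | _  = inj₁ (lookup⇒∈ ax , lookup⇒∉ ay)
  ... | false | true  | _  = inj₂ (lookup⇒∉ ax , lookup⇒∈ ay)
  ... | true  | true  | ()
  ... | false | false | ()

  ∈∂⇒crossing : ∀ {A h} → h ∈ ∂ G A → ∃₂ λ x y → Joins G h x y × x ∈ A × y ∉ A
  ∈∂⇒crossing {h = h} h∈∂A with ∈∂-ends (joins-ends h) h∈∂A
  ... | inj₁ (x∈A , y∉A) = _ , _ , joins-ends h , x∈A , y∉A
  ... | inj₂ (x∉A , y∈A) = _ , _ , joins-sym (joins-ends h) , y∈A , x∉A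

  inside⇒∉∂ : ∀ {A h x y} → Joins G h x y → x ∈ A → y ∈ A → h ∉ ∂ G A
  inside⇒∉∂ j x∈A y∈A h∈∂A with ∈∂-ends j h∈∂A
  ... | inj₁ (_ , y∉A) = y∉A y∈A
  ... | inj₂ (x∉A , _) = x∉A x∈A

  inside⇒∈EdgesIn : ∀ {S h x y} → Joins G h x y → x ∈ S → y ∈ S → h ∈ EdgesIn G S
  inside⇒∈EdgesIn {S} j x∈S y∈S =
    lookup⇒∈ (trans (EdgesIn-joins {S} j) (cong₂ _∧_ (∈⇒lookup x∈S) (∈⇒lookup y∈S)))

  ∈EdgesIn⇒inside : ∀ {S h x y} → Joins G h x y → h ∈ EdgesIn G S → x ∈ S × y ∈ S
  ∈EdgesIn⇒inside {S} {h} {x} {y} j h∈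
    with lookup S x in sx | lookup S y in sy | trans (sym (EdgesIn-joins {S} j)) (∈⇒lookup h∈)
  ... | true  | true  | _  = lookup⇒∈ sx , lookup⇒∈ sy
  ... | true  | false | ()
  ... | false | _     | ()

  ∈∂∩∂⇒between : ∀ {A B h} → A ∩ B ≡ ⊥ → h ∈ ∂ G A ∩ ∂ G B →
    ∃₂ λ a b → Joins G h a b × a ∈ A × b ∈ B
  ∈∂∩∂⇒between {A} {B} A∩B≡⊥ h∈ with x∈p∩q⁻ (∂ G A) (∂ G B) h∈
  ... | h∈∂A , h∈∂B with ∈∂⇒crossing h∈∂A
  ... | a , b , j , a∈A , b∉A with ∈∂-ends j h∈∂B
  ...   | inj₁ (a∈B , _) = contradiction a∈B (p∩q≡⊥⁻ A∩B≡⊥ a∈A)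
  ...   | inj₂ (_ , b∈B) = a , b , j , a∈A , b∈B

  ∂-∁ : ∀ A → ∂ G (∁ A) ≡ ∂ G A
  ∂-∁ A = subset-ext λ h → begin
    lookup (∂ G (∁ A)) h                                    ≡⟨ ∂-lookup (∁ A) h ⟩
    lookup (∁ A) (end₁ h) xor lookup (∁ A) (end₂ h)         ≡⟨ cong₂ _xor_ (lookup-∁ A _) (lookup-∁ A _) ⟩
    not (lookup A (end₁ h)) xor not (lookup A (end₂ h))     ≡⟨ not-xor-not (lookup A (end₁ h)) _ ⟩
    lookup A (end₁ h) xor lookup A (end₂ h)                 ≡⟨ ∂-lookup A h ⟨
    lookup (∂ G A) h                                        ∎
    where
    open ≡-Reasoning
    not-xor-not : ∀ a b → (not a xor not b) ≡ (a xor b)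
    not-xor-not true  b = refl
    not-xor-not false b = not-involutive b

  odd-side : ∀ T Z → Odd ∣ T ∣ → ∃ λ Z′ → ∂ G Z′ ≡ ∂ G Z × Odd ∣ T ∩ Z′ ∣
  odd-side T Z odd-T with Odd-+ ∣ T ∩ Z ∣ (subst Odd (∣p∣≡∣p∩q∣+∣p∩∁q∣ T Z) odd-T)
  ... | inj₁ odd-in  = Z , refl , odd-in
  ... | inj₂ odd-out = ∁ Z , ∂-∁ Z , odd-out

  ∣∂∪∣ : ∀ {A B} → A ∩ B ≡ ⊥ → ∣ ∂ G A ∣ + ∣ ∂ G B ∣ ≡ ∣ ∂ G (A ∪ B) ∣ + 2 * ∣ ∂ G A ∩ ∂ G B ∣
  ∣∂∪∣ {A} {B} A∩B≡⊥ = pointwise⇒∣p∣+∣q∣≡∣r∣+2∣s∣ {p = ∂ G A} {∂ G B} {∂ G (A ∪ B)} {∂ G A ∩ ∂ G B} pointwise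
    where
    pointwise : ∀ h → 𝟙 (lookup (∂ G A) h) + 𝟙 (lookup (∂ G B) h)
                    ≡ 𝟙 (lookup (∂ G (A ∪ B)) h) + 2 * 𝟙 (lookup (∂ G A ∩ ∂ G B) h)
    pointwise h
      rewrite lookup-∩ (∂ G A) (∂ G B) h | ∂-lookup A h | ∂-lookup B h | ∂-lookup (A ∪ B) h
            | lookup-∪ A B (end₁ h) | lookup-∪ A B (end₂ h)
      = xor-count (lookup A (end₁ h)) (lookup B (end₁ h)) (lookup A (end₂ h)) (lookup B (end₂ h))
                  (p∩q≡⊥⇒∧≡false A∩B≡⊥ (end₁ h)) (p∩q≡⊥⇒∧≡false A∩B≡⊥ (end₂ h))

  degree₄ : ∀ {A B C D} → Partition₄ A B C D →
    ∣ ∂ G A ∣ ≡ ∣ ∂ G A ∩ ∂ G B ∣ + ∣ ∂ G A ∩ ∂ G C ∣ + ∣ ∂ G A ∩ ∂ G D ∣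
  degree₄ {A} {B} {C} {D} P =
    pointwise⇒∣p∣≡∣q∣+∣r∣+∣s∣ {p = ∂ G A} {∂ G A ∩ ∂ G B} {∂ G A ∩ ∂ G C} {∂ G A ∩ ∂ G D} pointwise
    where
    pointwise : ∀ h → 𝟙 (lookup (∂ G A) h) ≡ 𝟙 (lookup (∂ G A ∩ ∂ G B) h)
                    + 𝟙 (lookup (∂ G A ∩ ∂ G C) h) + 𝟙 (lookup (∂ G A ∩ ∂ G D) h)
    pointwise h
      rewrite lookup-∩ (∂ G A) (∂ G B) h | lookup-∩ (∂ G A) (∂ G C) h | lookup-∩ (∂ G A) (∂ G D) h
            | ∂-lookup A h | ∂-lookup B h | ∂-lookup C h | ∂-lookup D h
      = degree-count (one-of P (end₁ h)) (one-of P (end₂ h))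

  ∂∩∂≡∂In : ∀ {A B} → A ∩ B ≡ ⊥ → ∂ G A ∩ ∂ G B ≡ ∂In G (A ∪ B) A
  ∂∩∂≡∂In {A} {B} A∩B≡⊥ = ⊆-antisym between⇒∂In ∂In⇒between
    where
    between⇒∂In : ∂ G A ∩ ∂ G B ⊆ ∂In G (A ∪ B) A
    between⇒∂In h∈ with ∈∂∩∂⇒between A∩B≡⊥ h∈
    ... | a , b , j , a∈A , b∈B =
      x∈p∩q⁺ ( crossing⇒∈∂ j a∈A (λ b∈A → p∩q≡⊥⁻ A∩B≡⊥ b∈A b∈B)
             , inside⇒∈EdgesIn j (x∈p∪q⁺ (inj₁ a∈A)) (x∈p∪q⁺ (inj₂ b∈B)))

    ∂In⇒between : ∂In G (A ∪ B) A ⊆ ∂ G A ∩ ∂ G B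
    ∂In⇒between h∈ with x∈p∩q⁻ (∂ G A) (EdgesIn G (A ∪ B)) h∈
    ... | h∈∂A , h∈G[A∪B] with ∈∂⇒crossing h∈∂A
    ... | a , b , j , a∈A , b∉A with x∈p∪q⁻ A B (proj₂ (∈EdgesIn⇒inside j h∈G[A∪B]))
    ...   | inj₁ b∈A = contradiction b∈A b∉A
    ...   | inj₂ b∈B = x∈p∩q⁺ (h∈∂A , crossing⇒∈∂ (joins-sym j) b∈B (p∩q≡⊥⁻ A∩B≡⊥ a∈A))

  ∂-parallel : ∀ A {h h′ x y} → Joins G h x y → Joins G h′ x y → lookup (∂ G A) h ≡ lookup (∂ G A) h′
  ∂-parallel A j j′ = trans (∂-joins {A} j) (sym (∂-joins {A} j′))

  parallel-∈∂ : ∀ {A h h′ x y} → Joins G h x y → Joins G h′ x y → h ∈ ∂ G A → h′ ∈ ∂ G A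
  parallel-∈∂ {A} j j′ h∈∂A = lookup⇒∈ (trans (sym (∂-parallel A j j′)) (∈⇒lookup h∈∂A))

-- Components of induced subgraphs

module Components (G : Graph) where
  open Cuts G

  reach-∈ : ∀ {S x y} → Reach G S x y → y ∈ S
  reach-∈ (here x∈S)         = x∈S
  reach-∈ (step _ _ _ z∈S)   = z∈S

  reach-crosses : ∀ {S A x y} → Reach G S x y → x ∈ A → y ∉ A → Nonempty (∂ G A)
  reach-crosses (here _) x∈A x∉A = contradiction x∈A x∉A
  reach-crosses {A = A} (step {y} h x⇝y j _) x∈A z∉A with y ∈? A
  ... | yes y∈A = h , crossing⇒∈∂ j y∈A z∉A
  ... | no  y∉A = reach-crosses x⇝y x∈A y∉A

  Closed : Subset (n G) → Subset (n G) → Set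
  Closed S K = ∀ {h y z} → Joins G h y z → y ∈ K → z ∈ S → z ∈ K

  record Component (S : Subset (n G)) (x : V G) : Set where
    field
      vertices  : Subset (n G)
      root      : x ∈ vertices
      closed    : Closed S vertices
      reachable : ∀ {y} → y ∈ vertices → Reach G S x y

  -- Each step adds a vertex of S joined to K by an edge of G[S]; as ∣ K ∣ ≤ n G, the
  -- invariant n G ≤ fuel + ∣ K ∣ rules out running out of fuel while such an edge exists.
  private
    grow : ∀ {S x} (fuel : ℕ) (K : Subset (n G)) → n G ≤ fuel + ∣ K ∣ →
      x ∈ K → (∀ {y} → y ∈ K → Reach G S x y) → Component S x
    grow {S} {x} fuel K bound x∈K reach with nonempty? (∂In G S K)
    ... | no ∄edge = record { vertices = K ; root = x∈K ; closed = closed ; reachable = reach }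
      where
      closed : Closed S K
      closed {h} {y} {z} j y∈K z∈S with z ∈? K
      ... | yes z∈K = z∈K
      ... | no  z∉K = contradiction
        (h , x∈p∩q⁺ (crossing⇒∈∂ j y∈K z∉K , inside⇒∈EdgesIn j (reach-∈ (reach y∈K)) z∈S)) ∄edge
    ... | yes (h , h∈) with x∈p∩q⁻ (∂ G K) (EdgesIn G S) h∈
    ... | h∈∂K , h∈G[S] with ∈∂⇒crossing h∈∂K
    ... | y , z , j , y∈K , z∉K = extend fuel bound
      where
      K′ : Subset (n G)
      K′ = K ∪ ⁅ z ⁆

      ∣K∣<∣K′∣ : ∣ K ∣ < ∣ K′ ∣
      ∣K∣<∣K′∣ = p⊂q⇒∣p∣<∣q∣ (p⊆p∪q ⁅ z ⁆ , z , x∈p∪q⁺ (inj₂ (x∈⁅x⁆ z)) , z∉K)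

      reach′ : ∀ {w} → w ∈ K′ → Reach G S x w
      reach′ w∈K′ with x∈p∪q⁻ K ⁅ z ⁆ w∈K′
      ... | inj₁ w∈K  = reach w∈K
      ... | inj₂ w∈⁅z⁆ rewrite x∈⁅y⁆⇒x≡y z w∈⁅z⁆ =
        step h (reach y∈K) j (proj₂ (∈EdgesIn⇒inside j h∈G[S]))

      extend : ∀ fuel → n G ≤ fuel + ∣ K ∣ → Component S x
      extend zero       bound = contradiction bound (<⇒≱ (<-≤-trans ∣K∣<∣K′∣ (∣p∣≤n K′)))
      extend (suc fuel) bound =
        grow fuel K′ (≤-trans bound (≤-trans (≤-reflexive (sym (+-suc fuel ∣ K ∣))) (+-monoʳ-≤ fuel ∣K∣<∣K′∣)))
             (x∈p∪q⁺ (inj₁ x∈K)) reach′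

  component : ∀ {S x} → x ∈ S → Component S x
  component {S} {x} x∈S = grow (n G) ⁅ x ⁆ (m≤m+n (n G) _) (x∈⁅x⁆ x) reach
    where
    reach : ∀ {y} → y ∈ ⁅ x ⁆ → Reach G S x y
    reach y∈⁅x⁆ rewrite x∈⁅y⁆⇒x≡y x y∈⁅x⁆ = here x∈S

-- Perfect matchings

module Matchings (G : Graph) where
  open Cuts G

  parallel-in-matching⇒≡ : ∀ {M h h′ x y} → PerfectMatching G M → h ∈ M → h′ ∈ M →
    Joins G h x y → Joins G h′ x y → h′ ≡ h
  parallel-in-matching⇒≡ {x = x} pm h∈M h′∈M j j′ =
    ∣p∣≡1⇒unique (pm x) (x∈p∩q⁺ (joins⇒∈∂v j′ , h′∈M)) (x∈p∩q⁺ (joins⇒∈∂v j , h∈M))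

  swap-parallel-matching : ∀ {M h h′ x y} → PerfectMatching G M →
    Joins G h x y → Joins G h′ x y → PerfectMatching G (swap h h′ M)
  swap-parallel-matching {M} {h} {h′} pm j j′ z = begin
    ∣ ∂v G z ∩ swap h h′ M ∣              ≡⟨ cong (λ D → ∣ D ∩ swap h h′ M ∣) ∂z-invariant ⟨
    ∣ swap h h′ (∂v G z) ∩ swap h h′ M ∣  ≡⟨ cong ∣_∣ (swap-∩ h h′ (∂v G z) M) ⟨
    ∣ swap h h′ (∂v G z ∩ M) ∣            ≡⟨ ∣swap∣ h h′ (∂v G z ∩ M) ⟩
    ∣ ∂v G z ∩ M ∣                        ≡⟨ pm z ⟩
    1                                     ∎
    where
    open ≡-Reasoning
    ∂z-invariant : swap h h′ (∂v G z) ≡ ∂v G z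
    ∂z-invariant = swap-invariant (∂v G z) (∂-parallel ⁅ z ⁆ j j′)

  solitary⇒simple-matching-edge : ∀ {e M h h′ x y} → Solitary G e → PerfectMatching G M → e ∈ M →
    h ∈ M → h ≢ e → Joins G h x y → Joins G h′ x y → h′ ≡ h
  solitary⇒simple-matching-edge {e} {M} {h} {h′} (M₀ , _ , _ , unique) pm e∈M h∈M h≢e j j′ =
    parallel-in-matching⇒≡ pm h∈M h′∈M j j′
    where
    e≢h′ : e ≢ h′
    e≢h′ refl = h≢e (sym (parallel-in-matching⇒≡ pm h∈M e∈M j j′))

    M′ : Subset (m G)
    M′ = swap h h′ M

    e∈M′ : e ∈ M′
    e∈M′ = lookup⇒∈ (trans (lookup-swap h h′ M e)
             (trans (cong (lookup M) (transpose-fixes (h≢e ∘ sym) e≢h′)) (∈⇒lookup e∈M)))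

    M′≡M : M′ ≡ M
    M′≡M = trans (unique M′ (swap-parallel-matching pm j j′) e∈M′) (sym (unique M pm e∈M))

    h′∈M : h′ ∈ M
    h′∈M = subst (h′ ∈_) M′≡M (lookup⇒∈ (trans (lookup-swap h h′ M h′)
             (trans (cong (lookup M) (transpose-j≡i h h′)) (∈⇒lookup h∈M))))

-- r-graphs

module RGraph {r : ℕ} {G : Graph} (RG : IsRGraph r G) where
  open Cuts G
  open Components G

  regular : ∀ x → ∣ ∂v G x ∣ ≡ r
  regular = proj₁ (proj₂ RG)

  odd-cut : ∀ A → Odd ∣ A ∣ → r ≤ ∣ ∂ G A ∣
  odd-cut = proj₂ (proj₂ RG)

  ∣∂∣≡0⇒Empty : ∀ {A w} → ∣ ∂ G A ∣ ≡ 0 → w ∉ A → Empty A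
  ∣∂∣≡0⇒Empty {A} {w} ∣∂A∣≡0 w∉A (x , x∈A) with reach-crosses (proj₁ RG x w ∈⊤ ∈⊤) x∈A w∉A
  ... | h , h∈∂A = contradiction ∣∂A∣≡0 (>⇒≢ (x∈p⇒0<∣p∣ h∈∂A))

  odd-shore-inside-or-outside : ∀ {S K T w} → Closed S K → T ⊆ S → Odd ∣ T ∣ → ∣ ∂ G T ∣ ≡ r → w ∉ T →
    T ⊆ K ⊎ Empty (T ∩ K)
  odd-shore-inside-or-outside {S} {K} {T} {w} closed T⊆S odd-T ∣∂T∣≡r w∉T =
    conclude (Odd-+ ∣ T ∩ K ∣ (subst Odd (∣p∣≡∣p∩q∣+∣p∩∁q∣ T K) odd-T))
    where
    open ≡-Reasoning

    inside-outside-disjoint : (T ∩ K) ∩ (T ∩ ∁ K) ≡ ⊥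
    inside-outside-disjoint = p∩q≡⊥⁺ λ x∈T∩K x∈T∩∁K →
      x∈∁p⇒x∉p (proj₂ (x∈p∩q⁻ T (∁ K) x∈T∩∁K)) (proj₂ (x∈p∩q⁻ T K x∈T∩K))

    no-edges : ∂ G (T ∩ K) ∩ ∂ G (T ∩ ∁ K) ≡ ⊥
    no-edges = Empty-unique λ (h , h∈) → case ∈∂∩∂⇒between inside-outside-disjoint h∈ of λ
      (a , b , j , a∈T∩K , b∈T∩∁K) →
        let (b∈T , b∈∁K) = x∈p∩q⁻ T (∁ K) b∈T∩∁K
        in x∈∁p⇒x∉p b∈∁K (closed j (proj₂ (x∈p∩q⁻ T K a∈T∩K)) (T⊆S b∈T))

    split : (T ∩ K) ∪ (T ∩ ∁ K) ≡ T
    split = begin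
      (T ∩ K) ∪ (T ∩ ∁ K) ≡⟨ ∩-distribˡ-∪ T K (∁ K) ⟨
      T ∩ (K ∪ ∁ K)       ≡⟨ cong (T ∩_) (p∪∁p≡⊤ K) ⟩
      T ∩ ⊤               ≡⟨ ∩-identityʳ T ⟩
      T                   ∎

    cuts : ∣ ∂ G (T ∩ K) ∣ + ∣ ∂ G (T ∩ ∁ K) ∣ ≡ r
    cuts = begin
      ∣ ∂ G (T ∩ K) ∣ + ∣ ∂ G (T ∩ ∁ K) ∣
        ≡⟨ ∣∂∪∣ inside-outside-disjoint ⟩
      ∣ ∂ G ((T ∩ K) ∪ (T ∩ ∁ K)) ∣ + 2 * ∣ ∂ G (T ∩ K) ∩ ∂ G (T ∩ ∁ K) ∣
        ≡⟨ cong₂ (λ A B → ∣ ∂ G A ∣ + 2 * ∣ B ∣) split no-edges ⟩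
      ∣ ∂ G T ∣ + 2 * ∣ ⊥ {m G} ∣
        ≡⟨ cong₂ (λ c e → c + 2 * e) ∣∂T∣≡r (∣⊥∣≡0 (m G)) ⟩
      r + 0
        ≡⟨ +-identityʳ r ⟩
      r ∎

    conclude : Odd ∣ T ∩ K ∣ ⊎ Odd ∣ T ∩ ∁ K ∣ → T ⊆ K ⊎ Empty (T ∩ K)
    conclude (inj₁ odd-in)  = inj₁ (Empty[p∩∁q]⇒p⊆q
      (∣∂∣≡0⇒Empty (m+n≡o≤m⇒n≡0 cuts (odd-cut (T ∩ K) odd-in)) (w∉T ∘ p∩q⊆p T (∁ K))))
    conclude (inj₂ odd-out) = inj₂
      (∣∂∣≡0⇒Empty (m+n≡o≤m⇒n≡0 (trans (+-comm ∣ ∂ G (T ∩ ∁ K) ∣ _) cuts) (odd-cut (T ∩ ∁ K) odd-out))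
                    (w∉T ∘ p∩q⊆p T K))

  adjacent-to-shore : EdgeConnected 3 G → ∀ {T w w′} → w ∉ T → w′ ∉ T → w ≢ w′ → ∣ ∂ G T ∣ ≡ r →
    ∣ ∂ G T ∣ ≡ 1 + ∣ ∂v G w ∩ ∂ G T ∣ + ∣ ∂v G w′ ∩ ∂ G T ∣ → ∃ λ x → x ∈ T × Adjacent G w x
  adjacent-to-shore 3-connected {T} {w} {w′} w∉T w′∉T w≢w′ ∣∂T∣≡r degree with nonempty? (∂v G w ∩ ∂ G T)
  ... | yes (h , h∈) with ∈∂∩∂⇒between (x∉p⇒⁅x⁆∩p≡⊥ w∉T) h∈
  ...   | _ , x , j , a∈⁅w⁆ , x∈T rewrite x∈⁅y⁆⇒x≡y w a∈⁅w⁆ = x , x∈T , h , j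
  adjacent-to-shore 3-connected {T} {w} {w′} w∉T w′∉T w≢w′ ∣∂T∣≡r degree | no ∄edge =
    contradiction (subst (3 ≤_) ∣∂[T∪w′]∣≡2 (3-connected (T ∪ ⁅ w′ ⁆)
                    (w′ , x∈p∪q⁺ (inj₂ (x∈⁅x⁆ w′))) (w , x∉p⇒x∈∁p w∉T∪⁅w′⁆)))
                  λ { (s≤s (s≤s ())) }
    where
    w∉T∪⁅w′⁆ : w ∉ T ∪ ⁅ w′ ⁆
    w∉T∪⁅w′⁆ w∈ with x∈p∪q⁻ T ⁅ w′ ⁆ w∈
    ... | inj₁ w∈T    = w∉T w∈T
    ... | inj₂ w∈⁅w′⁆ = w≢w′ (x∈⁅y⁆⇒x≡y w′ w∈⁅w′⁆)

    1+c≡r : 1 + ∣ ∂ G T ∩ ∂v G w′ ∣ ≡ r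
    1+c≡r = begin
      1 + ∣ ∂ G T ∩ ∂v G w′ ∣                               ≡⟨ cong suc (∣p∩q∣≡∣q∩p∣ (∂ G T) _) ⟩
      1 + 0 + ∣ ∂v G w′ ∩ ∂ G T ∣                           ≡⟨ cong (λ c → 1 + c + _) (Empty⇒∣p∣≡0 ∄edge) ⟨
      1 + ∣ ∂v G w ∩ ∂ G T ∣ + ∣ ∂v G w′ ∩ ∂ G T ∣          ≡⟨ degree ⟨
      ∣ ∂ G T ∣                                             ≡⟨ ∣∂T∣≡r ⟩
      r                                                     ∎
      where open ≡-Reasoning

    ∣∂[T∪w′]∣≡2 : ∣ ∂ G (T ∪ ⁅ w′ ⁆) ∣ ≡ 2
    ∣∂[T∪w′]∣≡2 = two-edge-cut-arithmetic
      (trans (cong₂ _+_ (sym ∣∂T∣≡r) (sym (regular w′))) (∣∂∪∣ (trans (∩-comm T ⁅ w′ ⁆) (x∉p⇒⁅x⁆∩p≡⊥ w′∉T))))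
      1+c≡r

module Configuration
  {r : ℕ} {G : Graph} (RG : IsRGraph r G)
  {e : E G} {u v : V G} (e-uv : Joins G e u v)
  {f : E G} {X : Subset (n G)}
  (X⊆S : X ⊆ ∁ (⁅ u ⁆ ∪ ⁅ v ⁆))
  (∂X≡f : ∂In G (∁ (⁅ u ⁆ ∪ ⁅ v ⁆)) X ≡ ⁅ f ⁆)
  (odd-X : Odd ∣ X ∣) (odd-Y : Odd ∣ ∁ (⁅ u ⁆ ∪ ⁅ v ⁆) ─ X ∣)
  where

  open Cuts G
  open Components G
  open Matchings G
  open RGraph RG
  open ≡-Reasoning

  S Y : Subset (n G)
  S = ∁ (⁅ u ⁆ ∪ ⁅ v ⁆)
  Y = S ─ X

  u≢v : u ≢ v
  u≢v = joins-≢ e-uv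

  ∈S⇒≢u : ∀ {w} → w ∈ S → w ∉ ⁅ u ⁆
  ∈S⇒≢u w∈S w∈⁅u⁆ = x∈∁p⇒x∉p w∈S (x∈p∪q⁺ (inj₁ w∈⁅u⁆))

  ∈S⇒≢v : ∀ {w} → w ∈ S → w ∉ ⁅ v ⁆
  ∈S⇒≢v w∈S w∈⁅v⁆ = x∈∁p⇒x∉p w∈S (x∈p∪q⁺ (inj₂ w∈⁅v⁆))

  u∉S : u ∉ S
  u∉S u∈S = ∈S⇒≢u u∈S (x∈⁅x⁆ u)

  v∉S : v ∉ S
  v∉S v∈S = ∈S⇒≢v v∈S (x∈⁅x⁆ v)

  Y⊆S : Y ⊆ S
  Y⊆S = p─q⊆p S X

  X∩Y≡⊥ : X ∩ Y ≡ ⊥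
  X∩Y≡⊥ = p∩[q─p]≡⊥ X S

  X∪Y≡S : X ∪ Y ≡ S
  X∪Y≡S = p∪[q─p]≡q X⊆S

  X∪Y∪u∪v≡⊤ : X ∪ Y ∪ ⁅ u ⁆ ∪ ⁅ v ⁆ ≡ ⊤
  X∪Y∪u∪v≡⊤ = begin
    X ∪ Y ∪ ⁅ u ⁆ ∪ ⁅ v ⁆          ≡⟨ ∪-assoc X Y _ ⟨
    (X ∪ Y) ∪ ⁅ u ⁆ ∪ ⁅ v ⁆        ≡⟨ cong (_∪ (⁅ u ⁆ ∪ ⁅ v ⁆)) X∪Y≡S ⟩
    S ∪ ⁅ u ⁆ ∪ ⁅ v ⁆              ≡⟨ ∪-comm S _ ⟩
    (⁅ u ⁆ ∪ ⁅ v ⁆) ∪ S            ≡⟨ p∪∁p≡⊤ (⁅ u ⁆ ∪ ⁅ v ⁆) ⟩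
    ⊤                              ∎

  partition : Partition₄ X Y ⁅ u ⁆ ⁅ v ⁆
  partition = partition₄ position
    where
    position : ∀ w → OneOf₄ (lookup X w) (lookup Y w) (lookup ⁅ u ⁆ w) (lookup ⁅ v ⁆ w)
    position w with x∈p∪q⁻ X _ (subst (w ∈_) (sym X∪Y∪u∪v≡⊤) ∈⊤)
    ... | inj₁ w∈X
      rewrite ∈⇒lookup w∈X | ∉⇒lookup (p∩q≡⊥⁻ X∩Y≡⊥ w∈X)
            | ∉⇒lookup (∈S⇒≢u (X⊆S w∈X)) | ∉⇒lookup (∈S⇒≢v (X⊆S w∈X)) = 1st
    ... | inj₂ w∈Y∪u∪v with x∈p∪q⁻ Y _ w∈Y∪u∪v
    ...   | inj₁ w∈Y
      rewrite ∉⇒lookup (λ w∈X → p∩q≡⊥⁻ X∩Y≡⊥ w∈X w∈Y) | ∈⇒lookup w∈Y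
            | ∉⇒lookup (∈S⇒≢u (Y⊆S w∈Y)) | ∉⇒lookup (∈S⇒≢v (Y⊆S w∈Y)) = 2nd
    ...   | inj₂ w∈u∪v with x∈p∪q⁻ ⁅ u ⁆ ⁅ v ⁆ w∈u∪v
    ...     | inj₁ w∈⁅u⁆
      rewrite x∈⁅y⁆⇒x≡y u w∈⁅u⁆ | ∉⇒lookup (u∉S ∘ X⊆S) | ∉⇒lookup (u∉S ∘ Y⊆S)
            | ∈⇒lookup (x∈⁅x⁆ u) | ∉⇒lookup (u≢v ∘ x∈⁅y⁆⇒x≡y v) = 3rd
    ...     | inj₂ w∈⁅v⁆
      rewrite x∈⁅y⁆⇒x≡y v w∈⁅v⁆ | ∉⇒lookup (v∉S ∘ X⊆S) | ∉⇒lookup (v∉S ∘ Y⊆S)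
            | ∉⇒lookup (u≢v ∘ sym ∘ x∈⁅y⁆⇒x≡y u) | ∈⇒lookup (x∈⁅x⁆ v) = 4th

  ∂X∩∂Y≡f : ∂ G X ∩ ∂ G Y ≡ ⁅ f ⁆
  ∂X∩∂Y≡f = begin
    ∂ G X ∩ ∂ G Y    ≡⟨ ∂∩∂≡∂In X∩Y≡⊥ ⟩
    ∂In G (X ∪ Y) X  ≡⟨ cong (λ T → ∂In G T X) X∪Y≡S ⟩
    ∂In G S X        ≡⟨ ∂X≡f ⟩
    ⁅ f ⁆            ∎

  ∣∂X∩∂Y∣≡1 : ∣ ∂ G X ∩ ∂ G Y ∣ ≡ 1
  ∣∂X∩∂Y∣≡1 = trans (cong ∣_∣ ∂X∩∂Y≡f) (∣⁅x⁆∣≡1 f)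

  degree-X : ∣ ∂ G X ∣ ≡ 1 + ∣ ∂v G u ∩ ∂ G X ∣ + ∣ ∂v G v ∩ ∂ G X ∣
  degree-X = trans (degree₄ partition)
    (cong₂ _+_ (cong₂ _+_ ∣∂X∩∂Y∣≡1 (∣p∩q∣≡∣q∩p∣ (∂ G X) _)) (∣p∩q∣≡∣q∩p∣ (∂ G X) _))

  degree-Y : ∣ ∂ G Y ∣ ≡ 1 + ∣ ∂v G u ∩ ∂ G Y ∣ + ∣ ∂v G v ∩ ∂ G Y ∣
  degree-Y = trans (degree₄ (Partition₄-swap₁₂ partition))
    (cong₂ _+_ (cong₂ _+_ (trans (∣p∩q∣≡∣q∩p∣ (∂ G Y) _) ∣∂X∩∂Y∣≡1) (∣p∩q∣≡∣q∩p∣ (∂ G Y) _)) (∣p∩q∣≡∣q∩p∣ (∂ G Y) _))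

  degree-u : r ≡ ∣ ∂v G u ∩ ∂ G X ∣ + ∣ ∂v G u ∩ ∂ G Y ∣ + ∣ ∂v G u ∩ ∂v G v ∣
  degree-u = trans (sym (regular u)) (degree₄ (Partition₄-swap₁₂ (Partition₄-swap₂₃ partition)))

  degree-v : r ≡ ∣ ∂v G v ∩ ∂ G X ∣ + ∣ ∂v G v ∩ ∂ G Y ∣ + ∣ ∂v G u ∩ ∂v G v ∣
  degree-v = trans (sym (regular v))
    (trans (degree₄ (Partition₄-swap₁₂ (Partition₄-swap₂₃ (Partition₄-swap₃₄ partition))))
           (cong (∣ ∂v G v ∩ ∂ G X ∣ + ∣ ∂v G v ∩ ∂ G Y ∣ +_) (∣p∩q∣≡∣q∩p∣ (∂v G v) (∂v G u))))

  e∈∂u∩∂v : e ∈ ∂v G u ∩ ∂v G v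
  e∈∂u∩∂v = x∈p∩q⁺ (joins⇒∈∂v e-uv , joins⇒∈∂v (joins-sym e-uv))

  counts : ∣ ∂ G X ∣ ≡ r × ∣ ∂ G Y ∣ ≡ r × ∣ ∂v G u ∩ ∂v G v ∣ ≡ 1
         × ∣ ∂v G u ∩ ∂ G X ∣ ≡ ∣ ∂v G v ∩ ∂ G Y ∣ × ∣ ∂v G v ∩ ∂ G X ∣ ≡ ∣ ∂v G u ∩ ∂ G Y ∣
  counts = degree-arithmetic degree-X degree-Y degree-u degree-v
             (odd-cut X odd-X) (odd-cut Y odd-Y) (x∈p⇒0<∣p∣ e∈∂u∩∂v)

  ∣∂X∣≡r : ∣ ∂ G X ∣ ≡ r
  ∣∂X∣≡r = proj₁ counts

  ∣∂Y∣≡r : ∣ ∂ G Y ∣ ≡ r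
  ∣∂Y∣≡r = proj₁ (proj₂ counts)

  ∣∂u∩∂v∣≡1 : ∣ ∂v G u ∩ ∂v G v ∣ ≡ 1
  ∣∂u∩∂v∣≡1 = proj₁ (proj₂ (proj₂ counts))

  shared-degrees : ∣ ∂v G u ∩ ∂ G X ∣ ≡ ∣ ∂v G v ∩ ∂ G Y ∣ × ∣ ∂v G v ∩ ∂ G X ∣ ≡ ∣ ∂v G u ∩ ∂ G Y ∣
  shared-degrees = proj₂ (proj₂ (proj₂ counts))

  f-ends : ∃₂ λ a b → Joins G f a b × a ∈ X × b ∈ Y
  f-ends = ∈∂∩∂⇒between X∩Y≡⊥ (subst (f ∈_) (sym ∂X∩∂Y≡f) (x∈⁅x⁆ f))

  S-sides : ∀ {z} → z ∈ S → z ∈ X ⊎ z ∈ Y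
  S-sides z∈S = x∈p∪q⁻ X Y (subst (_ ∈_) (sym X∪Y≡S) z∈S)

  component-contains-S : ∀ {x} → x ∈ S → (C : Component S x) → S ⊆ Component.vertices C
  component-contains-S {x} x∈S C = S⊆K
    where
    open Component C

    absorbed : ∀ {T} → T ⊆ S → Odd ∣ T ∣ → ∣ ∂ G T ∣ ≡ r → ∀ {z} → z ∈ T → z ∈ vertices → T ⊆ vertices
    absorbed T⊆S odd-T ∣∂T∣≡r z∈T z∈K with odd-shore-inside-or-outside closed T⊆S odd-T ∣∂T∣≡r (u∉S ∘ T⊆S)
    ... | inj₁ T⊆K = T⊆K
    ... | inj₂ ∄   = contradiction (_ , x∈p∩q⁺ (z∈T , z∈K)) ∄

    X-absorbed : ∀ {z} → z ∈ X → z ∈ vertices → X ⊆ vertices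
    X-absorbed = absorbed X⊆S odd-X ∣∂X∣≡r

    Y-absorbed : ∀ {z} → z ∈ Y → z ∈ vertices → Y ⊆ vertices
    Y-absorbed = absorbed Y⊆S odd-Y ∣∂Y∣≡r

    X⊆K×Y⊆K : x ∈ X ⊎ x ∈ Y → (∃₂ λ a b → Joins G f a b × a ∈ X × b ∈ Y) → X ⊆ vertices × Y ⊆ vertices
    X⊆K×Y⊆K (inj₁ x∈X) (a , b , j , a∈X , b∈Y) = X⊆K , Y-absorbed b∈Y (closed j (X⊆K a∈X) (Y⊆S b∈Y))
      where
      X⊆K : X ⊆ vertices
      X⊆K = X-absorbed x∈X root
    X⊆K×Y⊆K (inj₂ x∈Y) (a , b , j , a∈X , b∈Y) = X-absorbed a∈X (closed (joins-sym j) (Y⊆K b∈Y) (X⊆S a∈X)) , Y⊆K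
      where
      Y⊆K : Y ⊆ vertices
      Y⊆K = Y-absorbed x∈Y root

    S⊆K : S ⊆ vertices
    S⊆K z∈S with S-sides z∈S
    ... | inj₁ z∈X = proj₁ (X⊆K×Y⊆K (S-sides x∈S) f-ends) z∈X
    ... | inj₂ z∈Y = proj₂ (X⊆K×Y⊆K (S-sides x∈S) f-ends) z∈Y

  S-connected : ConnectedOn G S
  S-connected x y x∈S y∈S = Component.reachable C (component-contains-S x∈S C y∈S)
    where
    C : Component S x
    C = component x∈S

  neighbours : EdgeConnected 3 G →
    (∃ λ x → x ∈ X × Adjacent G u x) × (∃ λ y → y ∈ Y × Adjacent G u y)
    × (∃ λ x → x ∈ X × Adjacent G v x) × (∃ λ y → y ∈ Y × Adjacent G v y)
  neighbours 3-connected =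
      adjacent-to-shore 3-connected u∉X v∉X u≢v ∣∂X∣≡r degree-X
    , adjacent-to-shore 3-connected u∉Y v∉Y u≢v ∣∂Y∣≡r degree-Y
    , adjacent-to-shore 3-connected v∉X u∉X (u≢v ∘ sym) ∣∂X∣≡r
        (trans degree-X (cong suc (+-comm ∣ ∂v G u ∩ ∂ G X ∣ _)))
    , adjacent-to-shore 3-connected v∉Y u∉Y (u≢v ∘ sym) ∣∂Y∣≡r
        (trans degree-Y (cong suc (+-comm ∣ ∂v G u ∩ ∂ G Y ∣ _)))
    where
    u∉X : u ∉ X
    u∉X = u∉S ∘ X⊆S
    u∉Y : u ∉ Y
    u∉Y = u∉S ∘ Y⊆S
    v∉X : v ∉ X
    v∉X = v∉S ∘ X⊆S
    v∉Y : v ∉ Y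
    v∉Y = v∉S ∘ Y⊆S

  matching-edges-simple : Solitary G e → ∀ M → PerfectMatching G M → e ∈ M → ∀ e′ → e′ ∈ M →
    ∀ e″ x y → Joins G e′ x y → Joins G e″ x y → e″ ≡ e′
  matching-edges-simple sol M pm e∈M e′ e′∈M e″ x y j′ j″ with e′ ≟ e
  ... | no  e′≢e = solitary⇒simple-matching-edge sol pm e∈M e′∈M e′≢e j′ j″
  ... | yes refl = ∣p∣≡1⇒unique ∣∂u∩∂v∣≡1 e″∈∂u∩∂v e∈∂u∩∂v
    where
    e″∈∂u∩∂v : e″ ∈ ∂v G u ∩ ∂v G v
    e″∈∂u∩∂v = x∈p∩q⁺ ( parallel-∈∂ {⁅ u ⁆} j′ j″ (joins⇒∈∂v e-uv)
                       , parallel-∈∂ {⁅ v ⁆} j′ j″ (joins⇒∈∂v (joins-sym e-uv)))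

  ∣∂S∣+2≡r+r : ∣ ∂ G S ∣ + 2 ≡ r + r
  ∣∂S∣+2≡r+r = begin
    ∣ ∂ G S ∣ + 2                                              ≡⟨ cong (λ T → ∣ T ∣ + 2) (∂-∁ (⁅ u ⁆ ∪ ⁅ v ⁆)) ⟩
    ∣ ∂ G (⁅ u ⁆ ∪ ⁅ v ⁆) ∣ + 2 * 1                            ≡⟨ cong (λ k → ∣ ∂ G (⁅ u ⁆ ∪ ⁅ v ⁆) ∣ + 2 * k) ∣∂u∩∂v∣≡1 ⟨
    ∣ ∂ G (⁅ u ⁆ ∪ ⁅ v ⁆) ∣ + 2 * ∣ ∂v G u ∩ ∂v G v ∣          ≡⟨ ∣∂∪∣ (x∉p⇒⁅x⁆∩p≡⊥ (u≢v ∘ x∈⁅y⁆⇒x≡y v)) ⟨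
    ∣ ∂v G u ∣ + ∣ ∂v G v ∣                                    ≡⟨ cong₂ _+_ (regular u) (regular v) ⟩
    r + r                                                      ∎

  -- Z₁ and Z₂ are Z or its complement, chosen so that P and Q below are odd.  The edges of
  -- G[S] between P, Q and the rest W of S cross X, Z₁ or Z₂, so they are f or g.
  private
    module SecondBridge
      (3-connected : EdgeConnected 3 G)
      {g : E G} {Z : Subset (n G)} (∂Z≡g : ∂In G S Z ≡ ⁅ g ⁆) (g≢f : g ≢ f)
      {Z₁ Z₂ : Subset (n G)} (∂Z₁≡∂Z : ∂ G Z₁ ≡ ∂ G Z) (∂Z₂≡∂Z : ∂ G Z₂ ≡ ∂ G Z)
      (odd-P : Odd ∣ X ∩ Z₁ ∣) (odd-Q : Odd ∣ Y ∩ Z₂ ∣)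
      where

      P Q W : Subset (n G)
      P = X ∩ Z₁
      Q = Y ∩ Z₂
      W = S ─ (P ∪ Q)

      crosses-X : ∀ {h a b} → Joins G h a b → a ∈ S → b ∈ S → a ∈ X → b ∉ X → h ∈ ⁅ f ⁆ ∪ ⁅ g ⁆
      crosses-X j a∈S b∈S a∈X b∉X = x∈p∪q⁺ (inj₁ (subst (_ ∈_) ∂X≡f
        (x∈p∩q⁺ (crossing⇒∈∂ j a∈X b∉X , inside⇒∈EdgesIn j a∈S b∈S))))

      crosses-Z : ∀ {Z′ h a b} → ∂ G Z′ ≡ ∂ G Z → Joins G h a b → a ∈ S → b ∈ S → a ∈ Z′ → b ∉ Z′ →
        h ∈ ⁅ f ⁆ ∪ ⁅ g ⁆
      crosses-Z ∂Z′≡∂Z j a∈S b∈S a∈Z′ b∉Z′ = x∈p∪q⁺ (inj₂ (subst (_ ∈_) ∂Z≡g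
        (x∈p∩q⁺ (subst (_ ∈_) ∂Z′≡∂Z (crossing⇒∈∂ j a∈Z′ b∉Z′) , inside⇒∈EdgesIn j a∈S b∈S))))

      P⊆X : P ⊆ X
      P⊆X = p∩q⊆p X Z₁

      Q⊆Y : Q ⊆ Y
      Q⊆Y = p∩q⊆p Y Z₂

      P∪Q⊆S : P ∪ Q ⊆ S
      P∪Q⊆S z∈P∪Q with x∈p∪q⁻ P Q z∈P∪Q
      ... | inj₁ z∈P = X⊆S (P⊆X z∈P)
      ... | inj₂ z∈Q = Y⊆S (Q⊆Y z∈Q)

      P∩Q≡⊥ : P ∩ Q ≡ ⊥
      P∩Q≡⊥ = p∩q≡⊥⁺ λ z∈P z∈Q → p∩q≡⊥⁻ X∩Y≡⊥ (P⊆X z∈P) (Q⊆Y z∈Q)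

      W⊆S : W ⊆ S
      W⊆S = p─q⊆p S (P ∪ Q)

      [P∪Q]∩W≡⊥ : (P ∪ Q) ∩ W ≡ ⊥
      [P∪Q]∩W≡⊥ = p∩[q─p]≡⊥ (P ∪ Q) S

      outside-W : ∀ {z} → z ∈ S → z ∉ W → z ∈ P ∪ Q
      outside-W {z} z∈S z∉W with z ∈? P ∪ Q
      ... | yes z∈P∪Q = z∈P∪Q
      ... | no  z∉P∪Q = contradiction (x∈p∧x∉q⇒x∈p─q z∈S z∉P∪Q) z∉W

      g∈∂Z : g ∈ ∂ G Z
      g∈∂Z = proj₁ (x∈p∩q⁻ (∂ G Z) (EdgesIn G S) (subst (g ∈_) (sym ∂Z≡g) (x∈⁅x⁆ g)))

      g∈G[S] : g ∈ EdgesIn G S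
      g∈G[S] = proj₂ (x∈p∩q⁻ (∂ G Z) (EdgesIn G S) (subst (g ∈_) (sym ∂Z≡g) (x∈⁅x⁆ g)))

      g∉∂X : g ∉ ∂ G X
      g∉∂X g∈∂X = g≢f (x∈⁅y⁆⇒x≡y f (subst (g ∈_) ∂X≡f (x∈p∩q⁺ (g∈∂X , g∈G[S]))))

      P-Q-edges : ∂ G P ∩ ∂ G Q ⊆ ⁅ f ⁆ ∪ ⁅ g ⁆
      P-Q-edges h∈ with ∈∂∩∂⇒between P∩Q≡⊥ h∈
      ... | a , b , j , a∈P , b∈Q =
        crosses-X j (X⊆S (P⊆X a∈P)) (Y⊆S (Q⊆Y b∈Q)) (P⊆X a∈P) (λ b∈X → p∩q≡⊥⁻ X∩Y≡⊥ b∈X (Q⊆Y b∈Q))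

      PQ-W-edges : ∂ G (P ∪ Q) ∩ ∂ G W ⊆ ⁅ f ⁆ ∪ ⁅ g ⁆
      PQ-W-edges {h} h∈ with ∈∂∩∂⇒between [P∪Q]∩W≡⊥ h∈
      ... | a , b , j , a∈P∪Q , b∈W = by-sides (b ∈? X) (x∈p∪q⁻ P Q a∈P∪Q)
        where
        a∈S : a ∈ S
        a∈S = P∪Q⊆S a∈P∪Q

        b∈S : b ∈ S
        b∈S = W⊆S b∈W

        b∉P∪Q : b ∉ P ∪ Q
        b∉P∪Q = x∈p─q⇒x∉q b∈W

        by-sides : Dec (b ∈ X) → a ∈ P ⊎ a ∈ Q → h ∈ ⁅ f ⁆ ∪ ⁅ g ⁆
        by-sides (yes b∈X) (inj₁ a∈P) = crosses-Z ∂Z₁≡∂Z j a∈S b∈S (proj₂ (x∈p∩q⁻ X Z₁ a∈P))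
          (λ b∈Z₁ → b∉P∪Q (x∈p∪q⁺ (inj₁ (x∈p∩q⁺ (b∈X , b∈Z₁)))))
        by-sides (yes b∈X) (inj₂ a∈Q) = crosses-X (joins-sym j) b∈S a∈S b∈X
          (λ a∈X → p∩q≡⊥⁻ X∩Y≡⊥ a∈X (Q⊆Y a∈Q))
        by-sides (no  b∉X) (inj₁ a∈P) = crosses-X j a∈S b∈S (P⊆X a∈P) b∉X
        by-sides (no  b∉X) (inj₂ a∈Q) = crosses-Z ∂Z₂≡∂Z j a∈S b∈S (proj₂ (x∈p∩q⁻ Y Z₂ a∈Q))
          (λ b∈Z₂ → b∉P∪Q (x∈p∪q⁺ (inj₂ (x∈p∩q⁺ (x∈p∧x∉q⇒x∈p─q b∈S b∉X , b∈Z₂)))))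

      crossing-edges-disjoint : (∂ G P ∩ ∂ G Q) ∩ (∂ G (P ∪ Q) ∩ ∂ G W) ≡ ⊥
      crossing-edges-disjoint = p∩q≡⊥⁺ λ h∈∂P∩∂Q h∈∂[P∪Q]∩∂W → case ∈∂∩∂⇒between P∩Q≡⊥ h∈∂P∩∂Q of λ
        (a , b , j , a∈P , b∈Q) → inside⇒∉∂ j (x∈p∪q⁺ (inj₁ a∈P)) (x∈p∪q⁺ (inj₂ b∈Q))
                                    (proj₁ (x∈p∩q⁻ (∂ G (P ∪ Q)) (∂ G W) h∈∂[P∪Q]∩∂W))

      ∣∂W∣≤2 : ∣ ∂ G W ∣ ≤ 2
      ∣∂W∣≤2 = three-part-arithmetic {e₁ = ∣ ∂ G P ∩ ∂ G Q ∣} {e₂ = ∣ ∂ G (P ∪ Q) ∩ ∂ G W ∣}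
        (∣∂∪∣ P∩Q≡⊥)
        (trans (∣∂∪∣ [P∪Q]∩W≡⊥) (cong (λ T → ∣ ∂ G T ∣ + 2 * ∣ ∂ G (P ∪ Q) ∩ ∂ G W ∣) (p∪[q─p]≡q P∪Q⊆S)))
        ∣∂S∣+2≡r+r (odd-cut P odd-P) (odd-cut Q odd-Q)
        (≤-trans (∣p∣+∣q∣≤∣r∣ crossing-edges-disjoint P-Q-edges PQ-W-edges) (∣⁅i⁆∪⁅j⁆∣≤2 f g))

      g-leaves-P∪Q : ∀ {a b} → Joins G g a b → a ∈ P ∪ Q → b ∉ P ∪ Q
      g-leaves-P∪Q j a∈P∪Q b∈P∪Q with x∈p∪q⁻ P Q a∈P∪Q | x∈p∪q⁻ P Q b∈P∪Q
      ... | inj₁ a∈P | inj₁ b∈P =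
        inside⇒∉∂ j (proj₂ (x∈p∩q⁻ X Z₁ a∈P)) (proj₂ (x∈p∩q⁻ X Z₁ b∈P)) (subst (g ∈_) (sym ∂Z₁≡∂Z) g∈∂Z)
      ... | inj₁ a∈P | inj₂ b∈Q = g∉∂X (crossing⇒∈∂ j (P⊆X a∈P) (λ b∈X → p∩q≡⊥⁻ X∩Y≡⊥ b∈X (Q⊆Y b∈Q)))
      ... | inj₂ a∈Q | inj₁ b∈P = g∉∂X (crossing⇒∈∂ (joins-sym j) (P⊆X b∈P) (λ a∈X → p∩q≡⊥⁻ X∩Y≡⊥ a∈X (Q⊆Y a∈Q)))
      ... | inj₂ a∈Q | inj₂ b∈Q =
        inside⇒∉∂ j (proj₂ (x∈p∩q⁻ Y Z₂ a∈Q)) (proj₂ (x∈p∩q⁻ Y Z₂ b∈Q)) (subst (g ∈_) (sym ∂Z₂≡∂Z) g∈∂Z)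

      W-nonempty : Nonempty W
      W-nonempty with end₁ g ∈? W | end₂ g ∈? W
      ... | yes a∈W | _       = _ , a∈W
      ... | no  _   | yes b∈W = _ , b∈W
      ... | no  a∉W | no  b∉W =
        contradiction (outside-W b∈S b∉W) (g-leaves-P∪Q (joins-ends g) (outside-W a∈S a∉W))
        where
        a∈S : end₁ g ∈ S
        a∈S = proj₁ (∈EdgesIn⇒inside (joins-ends g) g∈G[S])
        b∈S : end₂ g ∈ S
        b∈S = proj₂ (∈EdgesIn⇒inside (joins-ends g) g∈G[S])

      3≤∣∂W∣ : 3 ≤ ∣ ∂ G W ∣
      3≤∣∂W∣ = 3-connected W W-nonempty (u , x∉p⇒x∈∁p (u∉S ∘ W⊆S))

  f-unique : EdgeConnected 3 G → ∀ {g Z} → ∂In G S Z ≡ ⁅ g ⁆ → g ≡ f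
  f-unique 3-connected {g} {Z} ∂Z≡g with g ≟ f
  ... | yes g≡f = g≡f
  ... | no  g≢f with odd-side X Z odd-X | odd-side Y Z odd-Y
  ...   | Z₁ , ∂Z₁≡∂Z , odd-P | Z₂ , ∂Z₂≡∂Z , odd-Q = contradiction 3≤∣∂W∣ (≤⇒≯ ∣∂W∣≤2)
    where open SecondBridge 3-connected {Z = Z} ∂Z≡g g≢f {Z₁} {Z₂} ∂Z₁≡∂Z ∂Z₂≡∂Z odd-P odd-Q

mainTheorem14 : (r : ℕ) (G : Graph) → 3 ≤ r → IsRGraph r G → 4 ≤ n G →
  (e : E G) (u v : V G) → Joins G e u v → Solitary G e →
  (f : E G) (X Y : Subset (n G)) →
  let S = ∁ (⁅ u ⁆ ∪ ⁅ v ⁆) in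
  f ∈ EdgesIn G S → X ⊆ S → Y ≡ S ─ X → ∂In G S X ≡ ⁅ f ⁆ →
  Odd ∣ X ∣ → Odd ∣ Y ∣ →
  let C = ∂ G X
      D = ∂ G Y in
  (Odd ∣ X ∣ × ∣ C ∣ ≡ r × Odd ∣ Y ∣ × ∣ D ∣ ≡ r)
  × (C ∩ D ≡ ⁅ f ⁆)
  × (X ∩ Y ≡ ⊥)
  × (X ∪ Y ∪ ⁅ u ⁆ ∪ ⁅ v ⁆ ≡ ⊤)
  × (∣ ∂v G u ∩ C ∣ ≡ ∣ ∂v G v ∩ D ∣ × ∣ ∂v G v ∩ C ∣ ≡ ∣ ∂v G u ∩ D ∣)
  × ConnectedOn G S
  × (∀ M → PerfectMatching G M → e ∈ M → ∀ e' → e' ∈ M →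
       ∀ e'' x y → Joins G e' x y → Joins G e'' x y → e'' ≡ e')
  × (EdgeConnected 3 G →
       (∃ λ x → x ∈ X × Adjacent G u x) × (∃ λ y → y ∈ Y × Adjacent G u y)
       × (∃ λ x → x ∈ X × Adjacent G v x) × (∃ λ y → y ∈ Y × Adjacent G v y)
       × (∀ (g : E G) (Z : Subset (n G)) → g ∈ EdgesIn G S → Z ⊆ S →
            ∂In G S Z ≡ ⁅ g ⁆ → g ≡ f))
mainTheorem14 r G _ RG _ e u v e-uv solitary f X Y _ X⊆S refl ∂X≡f odd-X odd-Y =
    (odd-X , ∣∂X∣≡r , odd-Y , ∣∂Y∣≡r)
  , ∂X∩∂Y≡f
  , X∩Y≡⊥
  , X∪Y∪u∪v≡⊤
  , shared-degrees
  , S-connected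
  , matching-edges-simple solitary
  , λ 3-connected → let (xu , yu , xv , yv) = neighbours 3-connected
                    in xu , yu , xv , yv , λ g Z _ _ ∂Z≡g → f-unique 3-connected {Z = Z} ∂Z≡g
  where open Configuration RG e-uv X⊆S ∂X≡f odd-X odd-Y
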